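{- Let $\{P_n\}_{n\ge 0}$ be the Catalan-Larcombe-French sequence, defined by $P_0=1$, $P_1=8$ and, for $n\ge 2$, $$n^2 P_n = 8(3n^2-3n+1)P_{n-1} - 128(n-1)^2 P_{n-2}.$$ Then $\{P_n\}_{n\ge 0}$ is ratio log-concave, that is, for all integers $n\ge 2$, $$\left(\frac{P_n}{P_{n-1}}\right)^2 \ge \frac{P_{n-1}}{P_{n-2}}\cdot\frac{P_{n+1}}{P_n}.$$
   Context: A real sequence $\{S_n\}$ is called ratio log-concave if the sequence of ratios $\{S_n/S_{n-1}\}$ is log-concave, i.e. $(S_n/S_{n-1})^2 \ge (S_{n-1}/S_{n-2})(S_{n+1}/S_n)$. -}

module Defs where

open import Data.Nat using (ℕ; zero; suc)
open import Data.Integer using (+_)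
open import Data.Rational using (ℚ; _+_; _-_; _*_; _÷_; _/_; 0ℚ; 1ℚ; ≢-nonZero)
open import Data.Rational.Properties using (_≟_)
open import Relation.Nullary using (yes; no)

⟦_⟧ : ℕ → ℚ
⟦ n ⟧ = (+ n) / 1

-- total division on ℚ with the convention x / 0 = 0 (only ever applied
-- to nonzero denominators in the theorem, since P n > 0)
infixl 7 _∕_
_∕_ : ℚ → ℚ → ℚ
p ∕ q with q ≟ 0ℚ
... | yes _ = 0ℚ
... | no q≢0 = _÷_ p q {{≢-nonZero q≢0}}

P : ℕ → ℚ
P zero = 1ℚ
P (suc zero) = ⟦ 8 ⟧
P (suc (suc m)) =
  (⟦ 8 ⟧ * (⟦ 3 ⟧ * n * n - ⟦ 3 ⟧ * n + 1ℚ) * P (suc m)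
    - ⟦ 128 ⟧ * (n - 1ℚ) * (n - 1ℚ) * P m) ∕ (n * n)
  where
  n : ℚ
  n = ⟦ suc (suc m) ⟧

-- Write rₙ = Pₙ / Pₙ₋₁. For n ≥ 5 the ratio satisfies 12 ≤ rₙ ≤ 16 (n − 1) / n: this holds at
-- n = 5 by computation and passes from n to n + 1 through the recurrence, each new bound
-- being a nonnegative combination of the old ones. Clearing denominators with the recurrence
-- turns rₙ² ≥ rₙ₋₁ rₙ₊₁ into the nonnegativity of a quartic form in (Pₙ₋₁, Pₙ). Multiplied by
-- (n − 4)⁴, that form is a quartic form in the two slacks of the bounds whose coefficients are
-- polynomials in n − 5 with nonnegative coefficients. The cases n = 2, 3, 4 are computed.

module Submission where

open import Defs
open import Level using (0ℓ)
open import Algebra.Bundles.Raw using (RawRing)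
open import Data.Empty using (⊥-elim)
open import Data.List using (List; []; _∷_)
open import Data.Nat as ℕ using (ℕ; zero; suc; _≥_; _∸_; s≤s; z≤n)
import Data.Nat.Properties as ℕP
open import Data.Integer as ℤ using (+≤+; +<+)
import Data.Integer.Properties as ℤP
open import Data.Rational as ℚ using (ℚ; 0ℚ; 1ℚ; _≤_; _<_; toℚᵘ; ≢-nonZero)
import Data.Rational.Properties as ℚP
import Data.Rational.Unnormalised as ℚᵘ
import Data.Rational.Unnormalised.Properties as ℚᵘP
open import Data.Rational.Solver using (module +-*-Solver)
open import Relation.Binary.PropositionalEquality
open import Relation.Nullary using (yes; no)
open import Relation.Nullary.Decidable using (from-yes)

open +-*-Solver using (Polynomial; con; _:+_; _:*_; _:-_; :-_; _:=_; solve)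

-- Coefficients of certificate below: substitute the inverse p = (n l + u) / (4 (n − 4)),
-- q = (16 (n − 1) l + 12 u) / (4 (n − 4)) of (p, q) ↦ (lower p q, upper n p q) into
-- (n − 4)⁴ · cross n p q and expand each coefficient of uⁱ l⁴⁻ⁱ in powers of n − 5.
c₀ c₁ c₂ c₃ c₄ : List ℕ
c₀ = 373760 ∷ 415232 ∷ 183616 ∷ 40384 ∷ 4416 ∷ 192 ∷ []
c₁ = 457472 ∷ 647040 ∷ 428464 ∷ 168352 ∷ 40976 ∷ 6000 ∷ 480 ∷ 16 ∷ []
c₂ = 171648 ∷ 232032 ∷ 136272 ∷ 42984 ∷ 7488 ∷ 672 ∷ 24 ∷ []
c₃ = 26008 ∷ 30472 ∷ 13718 ∷ 2904 ∷ 284 ∷ 10 ∷ []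
c₄ = 1396 ∷ 1308 ∷ 361 ∷ 36 ∷ 1 ∷ []

-- Written once over any raw ring with numerals κ, so that the instance at ℚ and the instance at
-- solver syntax agree definitionally. The variables are the index n, p = Pₙ₋₁ and q = Pₙ:
-- n² Pₙ = α n · Pₙ₋₁ − β n · Pₙ₋₂, next n p q = (n + 1)² Pₙ₊₁ and
-- cross n p q = (n + 1)² β n (q³ Pₙ₋₂ − p³ Pₙ₊₁).
module Expressions {c ℓ} (R : RawRing c ℓ) (κ : ℕ → RawRing.Carrier R) where
  open RawRing R

  infixl 6 _-_
  _-_ : Carrier → Carrier → Carrier
  x - y = x + - y

  horner : List ℕ → Carrier → Carrier
  horner []       _ = κ 0
  horner (a ∷ as) x = κ a + x * horner as x

  α β : Carrier → Carrier
  α n = κ 8 * (κ 3 * n * n - κ 3 * n + κ 1)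
  β n = κ 128 * (n - κ 1) * (n - κ 1)

  next : Carrier → Carrier → Carrier → Carrier
  next n p q = α (n + κ 1) * q - β (n + κ 1) * p

  lower : Carrier → Carrier → Carrier
  lower p q = q - κ 12 * p

  upper : Carrier → Carrier → Carrier → Carrier
  upper n p q = κ 16 * (n - κ 1) * p - n * q

  cross : Carrier → Carrier → Carrier → Carrier
  cross n p q = (n + κ 1) * (n + κ 1) * (q * q * q) * (α n * p - n * n * q)
              - β n * (p * p * p) * next n p q

  certificate : Carrier → Carrier → Carrier → Carrier
  certificate n p q =
      horner c₀ s * l * l * l * l + horner c₁ s * u * l * l * l + horner c₂ s * u * u * l * l
    + horner c₃ s * u * u * u * l + horner c₄ s * u * u * u * u
    where
    s = n - κ 5
    l = lower p q
    u = upper n p q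

polynomialRing : ℕ → RawRing 0ℓ 0ℓ
polynomialRing m = record
  { Carrier = Polynomial m ; _≈_ = _≡_ ; _+_ = _:+_ ; _*_ = _:*_ ; -_ = :-_
  ; 0# = con 0ℚ ; 1# = con 1ℚ }

open Expressions ℚ.+-*-rawRing ⟦_⟧ hiding (_-_)
module Syntax {m} = Expressions (polynomialRing m) (λ k → con ⟦ k ⟧)
open import Data.Rational using (_+_; _-_; _*_; -_; 1/_)

toℚᵘ-⟦⟧ : ∀ n → toℚᵘ ⟦ n ⟧ ℚᵘ.≃ ℚᵘ.mkℚᵘ (ℤ.+ n) 0
toℚᵘ-⟦⟧ n = ℚP.toℚᵘ-fromℚᵘ (ℚᵘ.mkℚᵘ (ℤ.+ n) 0)

⟦⟧-suc : ∀ n → ⟦ suc n ⟧ ≡ ⟦ n ⟧ + 1ℚ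
⟦⟧-suc n = ℚP.toℚᵘ-injective (begin
  toℚᵘ ⟦ suc n ⟧                        ≈⟨ toℚᵘ-⟦⟧ (suc n) ⟩
  ℚᵘ.mkℚᵘ (ℤ.+ suc n) 0                   ≈⟨ ℚᵘ.*≡* numerators ⟩
  ℚᵘ.mkℚᵘ (ℤ.+ n) 0 ℚᵘ.+ ℚᵘ.mkℚᵘ (ℤ.+ 1) 0  ≈⟨ ℚᵘP.+-cong (toℚᵘ-⟦⟧ n) (toℚᵘ-⟦⟧ 1) ⟨
  toℚᵘ ⟦ n ⟧ ℚᵘ.+ toℚᵘ 1ℚ               ≈⟨ ℚP.toℚᵘ-homo-+ ⟦ n ⟧ 1ℚ ⟨
  toℚᵘ (⟦ n ⟧ + 1ℚ)                     ∎)
  where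
  open ℚᵘP.≃-Reasoning
  numerators : ℤ.+ suc n ℤ.* ℤ.+ 1 ≡ (ℤ.+ n ℤ.* ℤ.+ 1 ℤ.+ ℤ.+ 1 ℤ.* ℤ.+ 1) ℤ.* ℤ.+ 1
  numerators = trans (ℤP.*-identityʳ _) (sym (trans (ℤP.*-identityʳ _)
    (trans (cong (ℤ._+ ℤ.+ 1) (ℤP.*-identityʳ (ℤ.+ n))) (cong ℤ.+_ (ℕP.+-comm n 1)))))

⟦⟧-mono-≤ : ∀ {m n} → m ℕ.≤ n → ⟦ m ⟧ ≤ ⟦ n ⟧
⟦⟧-mono-≤ {m} {n} m≤n = ℚP.toℚᵘ-cancel-≤
  (ℚᵘP.≤-respˡ-≃ (ℚᵘP.≃-sym (toℚᵘ-⟦⟧ m)) (ℚᵘP.≤-respʳ-≃ (ℚᵘP.≃-sym (toℚᵘ-⟦⟧ n))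
    (ℚᵘ.*≤* (ℤP.*-monoʳ-≤-nonNeg (ℤ.+ 1) (+≤+ m≤n)))))

⟦⟧-mono-< : ∀ {m n} → m ℕ.< n → ⟦ m ⟧ < ⟦ n ⟧
⟦⟧-mono-< {m} {n} m<n = ℚP.toℚᵘ-cancel-<
  (ℚᵘP.<-respˡ-≃ (ℚᵘP.≃-sym (toℚᵘ-⟦⟧ m)) (ℚᵘP.<-respʳ-≃ (ℚᵘP.≃-sym (toℚᵘ-⟦⟧ n))
    (ℚᵘ.*<* (ℤP.*-monoʳ-<-pos (ℤ.+ 1) (+<+ m<n)))))

⟦⟧-nonNeg : ∀ n → 0ℚ ≤ ⟦ n ⟧
⟦⟧-nonNeg n = ⟦⟧-mono-≤ {0} {n} z≤n

⟦⟧-pos : ∀ n → 0ℚ < ⟦ suc n ⟧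
⟦⟧-pos n = ⟦⟧-mono-< {0} {suc n} (s≤s z≤n)

+-nonNeg : ∀ {x y} → 0ℚ ≤ x → 0ℚ ≤ y → 0ℚ ≤ x + y
+-nonNeg = ℚP.+-mono-≤

+-pos : ∀ {x y} → 0ℚ < x → 0ℚ < y → 0ℚ < x + y
+-pos = ℚP.+-mono-<

*-nonNeg : ∀ {x y} → 0ℚ ≤ x → 0ℚ ≤ y → 0ℚ ≤ x * y
*-nonNeg {x} {y} 0≤x 0≤y = ℚP.nonNegative⁻¹ (x * y)
  {{ℚP.nonNeg*nonNeg⇒nonNeg x {{ℚ.nonNegative 0≤x}} y {{ℚ.nonNegative 0≤y}}}}

*-pos : ∀ {x y} → 0ℚ < x → 0ℚ < y → 0ℚ < x * y
*-pos {x} {y} 0<x 0<y = ℚP.positive⁻¹ (x * y)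
  {{ℚP.pos*pos⇒pos x {{ℚ.positive 0<x}} y {{ℚ.positive 0<y}}}}

*-cancelˡ-nonNeg : ∀ {c x} → 0ℚ < c → 0ℚ ≤ c * x → 0ℚ ≤ x
*-cancelˡ-nonNeg {c} {x} 0<c 0≤cx =
  ℚP.*-cancelˡ-≤-pos c {{ℚ.positive 0<c}} (subst (_≤ c * x) (sym (ℚP.*-zeroʳ c)) 0≤cx)

p≤q⇒0≤q-p : ∀ {p q} → p ≤ q → 0ℚ ≤ q - p
p≤q⇒0≤q-p {p} {q} p≤q = subst (_≤ q - p) (ℚP.+-inverseʳ p) (ℚP.+-monoˡ-≤ (- p) p≤q)

p<q⇒0<q-p : ∀ {p q} → p < q → 0ℚ < q - p
p<q⇒0<q-p {p} {q} p<q = subst (_< q - p) (ℚP.+-inverseʳ p) (ℚP.+-monoˡ-< (- p) p<q)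

0≤q-p⇒p≤q : ∀ {p q} → 0ℚ ≤ q - p → p ≤ q
0≤q-p⇒p≤q {p} {q} 0≤q-p = subst₂ _≤_ (ℚP.+-identityˡ p) q-p+p≡q (ℚP.+-monoˡ-≤ p 0≤q-p)
  where
  q-p+p≡q : q - p + p ≡ q
  q-p+p≡q = trans (ℚP.+-assoc q (- p) p) (trans (cong (q +_) (ℚP.+-inverseˡ p)) (ℚP.+-identityʳ q))

+-vanishing : ∀ {x y z} c → 0ℚ ≤ x → y ≡ z → 0ℚ ≤ x + c * (y - z)
+-vanishing {x} {_} {z} c 0≤x refl = subst (0ℚ ≤_) (sym x+c*0≡x) 0≤x
  where
  x+c*0≡x : x + c * (z - z) ≡ x
  x+c*0≡x = trans (cong (λ t → x + c * t) (ℚP.+-inverseʳ z))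
              (trans (cong (x +_) (ℚP.*-zeroʳ c)) (ℚP.+-identityʳ x))

horner-nonNeg : ∀ as {x} → 0ℚ ≤ x → 0ℚ ≤ horner as x
horner-nonNeg []       _   = ℚP.≤-refl
horner-nonNeg (a ∷ as) 0≤x = +-nonNeg (⟦⟧-nonNeg a) (*-nonNeg 0≤x (horner-nonNeg as 0≤x))

certificate-nonNeg : ∀ {n p q} → 0ℚ ≤ n - ⟦ 5 ⟧ → 0ℚ ≤ lower p q → 0ℚ ≤ upper n p q →
                     0ℚ ≤ certificate n p q
certificate-nonNeg {n} 0≤s l u =
  +-nonNeg (+-nonNeg (+-nonNeg (+-nonNeg
    (h c₀ ⋆ l ⋆ l ⋆ l ⋆ l) (h c₁ ⋆ u ⋆ l ⋆ l ⋆ l)) (h c₂ ⋆ u ⋆ u ⋆ l ⋆ l))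
    (h c₃ ⋆ u ⋆ u ⋆ u ⋆ l)) (h c₄ ⋆ u ⋆ u ⋆ u ⋆ u)
  where
  infixl 7 _⋆_
  _⋆_ : ∀ {x y} → 0ℚ ≤ x → 0ℚ ≤ y → 0ℚ ≤ x * y
  _⋆_ = *-nonNeg
  h : ∀ as → 0ℚ ≤ horner as (n - ⟦ 5 ⟧)
  h as = horner-nonNeg as 0≤s

*-∕-cancel : ∀ x {y} → 0ℚ < y → y * (x ∕ y) ≡ x
*-∕-cancel x {y} 0<y with y ℚP.≟ 0ℚ
... | yes y≡0 = ⊥-elim (ℚP.<-irrefl (sym y≡0) 0<y)
... | no  y≢0 = begin
  y * (x * 1/ y)    ≡⟨ ℚP.*-comm y _ ⟩
  x * 1/ y * y      ≡⟨ ℚP.*-assoc x _ y ⟩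
  x * (1/ y * y)    ≡⟨ cong (x *_) (ℚP.*-inverseˡ y) ⟩
  x * 1ℚ            ≡⟨ ℚP.*-identityʳ x ⟩
  x                 ∎
  where
  open ≡-Reasoning
  instance _ = ≢-nonZero y≢0

cross-certificate : ∀ n p q →
  (n - ⟦ 4 ⟧) * (n - ⟦ 4 ⟧) * (n - ⟦ 4 ⟧) * (n - ⟦ 4 ⟧) * cross n p q ≡ certificate n p q
cross-certificate = solve 3 (λ n p q → let d = n :- con ⟦ 4 ⟧ in
  d :* d :* d :* d :* Syntax.cross n p q := Syntax.certificate n p q) refl

-- The last summands vanish along P, by the recurrence.
lower-step-identity : ∀ n p q r →
  ⟦ 3 ⟧ * ((n + ⟦ 1 ⟧) * (n + ⟦ 1 ⟧)) * lower q r
    ≡ ⟦ 32 ⟧ * n * n * lower p q + horner (88 ∷ 40 ∷ 4 ∷ []) (n - ⟦ 5 ⟧) * q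
      + ⟦ 3 ⟧ * ((n + ⟦ 1 ⟧) * (n + ⟦ 1 ⟧) * r - next n p q)
lower-step-identity = solve 4 (λ n p q r → let n₁ = n :+ con ⟦ 1 ⟧ in
  con ⟦ 3 ⟧ :* (n₁ :* n₁) :* Syntax.lower q r
    := con ⟦ 32 ⟧ :* n :* n :* Syntax.lower p q
       :+ Syntax.horner (88 ∷ 40 ∷ 4 ∷ []) (n :- con ⟦ 5 ⟧) :* q
       :+ con ⟦ 3 ⟧ :* (n₁ :* n₁ :* r :- Syntax.next n p q)) refl

upper-step-identity : ∀ n p q r →
  (n - ⟦ 1 ⟧) * (n + ⟦ 1 ⟧) * upper (n + ⟦ 1 ⟧) q r
    ≡ ⟦ 8 ⟧ * n * n * upper n p q + ⟦ 8 ⟧ * q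
      + (⟦ 1 ⟧ - n) * ((n + ⟦ 1 ⟧) * (n + ⟦ 1 ⟧) * r - next n p q)
upper-step-identity = solve 4 (λ n p q r → let n₁ = n :+ con ⟦ 1 ⟧ in
  (n :- con ⟦ 1 ⟧) :* n₁ :* Syntax.upper n₁ q r
    := con ⟦ 8 ⟧ :* n :* n :* Syntax.upper n p q :+ con ⟦ 8 ⟧ :* q
       :+ (con ⟦ 1 ⟧ :- n) :* (n₁ :* n₁ :* r :- Syntax.next n p q)) refl

cross-identity : ∀ n p q x₀ x₃ →
  (n + ⟦ 1 ⟧) * (n + ⟦ 1 ⟧) * β n * (q * q * q * x₀ - p * p * p * x₃)
    ≡ cross n p q
      + (n + ⟦ 1 ⟧) * (n + ⟦ 1 ⟧) * (q * q * q) * (n * n * q - (α n * p - β n * x₀))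
      + - (β n * (p * p * p)) * ((n + ⟦ 1 ⟧) * (n + ⟦ 1 ⟧) * x₃ - next n p q)
cross-identity = solve 5 (λ n p q x₀ x₃ → let n₁ = n :+ con ⟦ 1 ⟧ in
  n₁ :* n₁ :* Syntax.β n :* (q :* q :* q :* x₀ :- p :* p :* p :* x₃)
    := Syntax.cross n p q
       :+ n₁ :* n₁ :* (q :* q :* q) :* (n :* n :* q :- (Syntax.α n :* p :- Syntax.β n :* x₀))
       :+ :- (Syntax.β n :* (p :* p :* p)) :* (n₁ :* n₁ :* x₃ :- Syntax.next n p q)) refl

P-recurrence : ∀ m →
  ⟦ 2 ℕ.+ m ⟧ * ⟦ 2 ℕ.+ m ⟧ * P (2 ℕ.+ m) ≡ α ⟦ 2 ℕ.+ m ⟧ * P (1 ℕ.+ m) - β ⟦ 2 ℕ.+ m ⟧ * P m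
P-recurrence m = *-∕-cancel _ (*-pos (⟦⟧-pos (suc m)) (⟦⟧-pos (suc m)))

P-next : ∀ m →
  (⟦ suc m ⟧ + ⟦ 1 ⟧) * (⟦ suc m ⟧ + ⟦ 1 ⟧) * P (2 ℕ.+ m) ≡ next ⟦ suc m ⟧ (P m) (P (suc m))
P-next m = subst (λ n → n * n * P (2 ℕ.+ m) ≡ α n * P (1 ℕ.+ m) - β n * P m)
                 (⟦⟧-suc (suc m)) (P-recurrence m)

record Bounds (m : ℕ) : Set where
  field
    P-pos        : 0ℚ < P m
    lower-nonNeg : 0ℚ ≤ lower (P m) (P (suc m))
    upper-nonNeg : 0ℚ ≤ upper ⟦ suc m ⟧ (P m) (P (suc m))

module Index (k : ℕ) where
  n : ℚ
  n = ⟦ 5 ℕ.+ k ⟧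

  0<n : 0ℚ < n
  0<n = ⟦⟧-pos (4 ℕ.+ k)

  0<n+1 : 0ℚ < n + ⟦ 1 ⟧
  0<n+1 = +-pos 0<n (⟦⟧-pos 0)

  0<n-1 : 0ℚ < n - ⟦ 1 ⟧
  0<n-1 = p<q⇒0<q-p (⟦⟧-mono-< {1} {5 ℕ.+ k} (s≤s (s≤s z≤n)))

  0<n-4 : 0ℚ < n - ⟦ 4 ⟧
  0<n-4 = p<q⇒0<q-p (⟦⟧-mono-< {4} {5 ℕ.+ k} (ℕP.m≤m+n 5 k))

  0≤n-5 : 0ℚ ≤ n - ⟦ 5 ⟧
  0≤n-5 = p≤q⇒0≤q-p (⟦⟧-mono-≤ {5} {5 ℕ.+ k} (ℕP.m≤m+n 5 k))

bounds-step : ∀ k → Bounds (4 ℕ.+ k) → Bounds (5 ℕ.+ k)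
bounds-step k b = record { P-pos = 0<q ; lower-nonNeg = 0≤lower ; upper-nonNeg = 0≤upper }
  where
  open Bounds b
  open Index k
  p q r : ℚ
  p = P (4 ℕ.+ k)
  q = P (5 ℕ.+ k)
  r = P (6 ℕ.+ k)

  0≤n : 0ℚ ≤ n
  0≤n = ℚP.<⇒≤ 0<n

  0<q : 0ℚ < q
  0<q = ℚP.<-≤-trans (*-pos (⟦⟧-pos 11) P-pos) (0≤q-p⇒p≤q lower-nonNeg)

  0≤lower : 0ℚ ≤ lower q r
  0≤lower = *-cancelˡ-nonNeg (*-pos (⟦⟧-pos 2) (*-pos 0<n+1 0<n+1))
    (subst (0ℚ ≤_) (sym (lower-step-identity n p q r))
      (+-vanishing ⟦ 3 ⟧
        (+-nonNeg (*-nonNeg (*-nonNeg (*-nonNeg (⟦⟧-nonNeg 32) 0≤n) 0≤n) lower-nonNeg)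
                  (*-nonNeg (horner-nonNeg (88 ∷ 40 ∷ 4 ∷ []) 0≤n-5) (ℚP.<⇒≤ 0<q)))
        (P-next (4 ℕ.+ k))))

  0≤upper : 0ℚ ≤ upper ⟦ 6 ℕ.+ k ⟧ q r
  0≤upper = subst (λ n′ → 0ℚ ≤ upper n′ q r) (sym (⟦⟧-suc (5 ℕ.+ k)))
    (*-cancelˡ-nonNeg (*-pos 0<n-1 0<n+1)
      (subst (0ℚ ≤_) (sym (upper-step-identity n p q r))
        (+-vanishing (⟦ 1 ⟧ - n)
          (+-nonNeg (*-nonNeg (*-nonNeg (*-nonNeg (⟦⟧-nonNeg 8) 0≤n) 0≤n) upper-nonNeg)
                    (*-nonNeg (⟦⟧-nonNeg 8) (ℚP.<⇒≤ 0<q)))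
          (P-next (4 ℕ.+ k)))))

bounds : ∀ k → Bounds (4 ℕ.+ k)
bounds zero = record
  { P-pos        = from-yes (0ℚ ℚP.<? P 4)
  ; lower-nonNeg = from-yes (0ℚ ℚP.≤? lower (P 4) (P 5))
  ; upper-nonNeg = from-yes (0ℚ ℚP.≤? upper ⟦ 5 ⟧ (P 4) (P 5))
  }
bounds (suc k) = bounds-step k (bounds k)

P-pos : ∀ m → 0ℚ < P m
P-pos 0 = from-yes (0ℚ ℚP.<? P 0)
P-pos 1 = from-yes (0ℚ ℚP.<? P 1)
P-pos 2 = from-yes (0ℚ ℚP.<? P 2)
P-pos 3 = from-yes (0ℚ ℚP.<? P 3)
P-pos (suc (suc (suc (suc k)))) = Bounds.P-pos (bounds k)

cross-nonNeg : ∀ k → 0ℚ ≤ cross ⟦ 5 ℕ.+ k ⟧ (P (4 ℕ.+ k)) (P (5 ℕ.+ k))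
cross-nonNeg k = *-cancelˡ-nonNeg (*-pos (*-pos (*-pos 0<n-4 0<n-4) 0<n-4) 0<n-4)
  (subst (0ℚ ≤_) (sym (cross-certificate n p q))
    (certificate-nonNeg {n} {p} {q} 0≤n-5 lower-nonNeg upper-nonNeg))
  where
  open Bounds (bounds k)
  open Index k
  p q : ℚ
  p = P (4 ℕ.+ k)
  q = P (5 ℕ.+ k)

cubic-inequality : ∀ k → let p = P (4 ℕ.+ k); q = P (5 ℕ.+ k) in
  p * p * p * P (6 ℕ.+ k) ≤ q * q * q * P (3 ℕ.+ k)
cubic-inequality k = 0≤q-p⇒p≤q (*-cancelˡ-nonNeg 0<multiplier
  (subst (0ℚ ≤_) (sym (cross-identity n p q x₀ x₃))
    (+-vanishing (- (β n * (p * p * p)))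
      (+-vanishing ((n + ⟦ 1 ⟧) * (n + ⟦ 1 ⟧) * (q * q * q)) (cross-nonNeg k) (P-recurrence (3 ℕ.+ k)))
      (P-next (4 ℕ.+ k)))))
  where
  open Index k
  x₀ p q x₃ : ℚ
  x₀ = P (3 ℕ.+ k)
  p = P (4 ℕ.+ k)
  q = P (5 ℕ.+ k)
  x₃ = P (6 ℕ.+ k)
  0<multiplier : 0ℚ < (n + ⟦ 1 ⟧) * (n + ⟦ 1 ⟧) * β n
  0<multiplier = *-pos (*-pos 0<n+1 0<n+1) (*-pos (*-pos (⟦⟧-pos 127) 0<n-1) 0<n-1)

cubic⇒ratio-≤ : ∀ {a b c d} → 0ℚ < a → 0ℚ < b → 0ℚ < c →
                b * b * b * d ≤ c * c * c * a → (b ∕ a) * (d ∕ c) ≤ (c ∕ b) * (c ∕ b)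
cubic⇒ratio-≤ {a} {b} {c} {d} 0<a 0<b 0<c b³d≤c³a =
  ℚP.*-cancelʳ-≤-pos w {{ℚ.positive 0<w}} (subst₂ _≤_ (sym left) (sym right) b³d≤c³a)
  where
  w : ℚ
  w = a * b * b * c
  0<w : 0ℚ < w
  0<w = *-pos (*-pos (*-pos 0<a 0<b) 0<b) 0<c
  left : (b ∕ a) * (d ∕ c) * w ≡ b * b * b * d
  left = trans (solve 6 (λ a b c d u v → u :* v :* (a :* b :* b :* c) := b :* b :* (a :* u) :* (c :* v))
                  refl a b c d (b ∕ a) (d ∕ c))
               (cong₂ (λ x y → b * b * x * y) (*-∕-cancel b 0<a) (*-∕-cancel d 0<c))
  right : (c ∕ b) * (c ∕ b) * w ≡ c * c * c * a
  right = trans (solve 4 (λ a b c u → u :* u :* (a :* b :* b :* c) := (b :* u) :* (b :* u) :* c :* a)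
                   refl a b c (c ∕ b))
                (cong (λ x → x * x * c * a) (*-∕-cancel c 0<b))

theorem1p2 : ∀ (n : ℕ) → n ≥ 2 →
    (P (n ∸ 1) ∕ P (n ∸ 2)) * (P (suc n) ∕ P n) ≤ (P n ∕ P (n ∸ 1)) * (P n ∕ P (n ∸ 1))
theorem1p2 0 ()
theorem1p2 1 (s≤s ())
theorem1p2 2 _ = from-yes ((P 1 ∕ P 0) * (P 3 ∕ P 2) ℚP.≤? (P 2 ∕ P 1) * (P 2 ∕ P 1))
theorem1p2 3 _ = from-yes ((P 2 ∕ P 1) * (P 4 ∕ P 3) ℚP.≤? (P 3 ∕ P 2) * (P 3 ∕ P 2))
theorem1p2 4 _ = from-yes ((P 3 ∕ P 2) * (P 5 ∕ P 4) ℚP.≤? (P 4 ∕ P 3) * (P 4 ∕ P 3))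
theorem1p2 (suc (suc (suc (suc (suc k))))) _ =
  cubic⇒ratio-≤ (P-pos (3 ℕ.+ k)) (P-pos (4 ℕ.+ k)) (P-pos (5 ℕ.+ k)) (cubic-inequality k)
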